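{- Let $M$ be a cellular pseudomanifold. (a) For vertices $x,y$ of $M$, $x\sim y$ implies that every facet of $M$ is incident with $x$ or $y$. (b) If $A$ is a $\sim$-equivalence class and $\alpha$ is a face with $\mathrm{sh}(\alpha)\cap A=\emptyset$, then for every proper subset $B$ of $A$, $\mathrm{sh}(\alpha)\cup B$ is the shadow of a face. (c) For $U\subseteq V(M)$, let $\widehat U$ be the union of all the $\sim$-equivalence classes contained in $U$. Then $U$ is the shadow of a face if and only if $\widehat U$ is the shadow of a face. (d) Let $\sigma$ and $\tau$ be two facets adjacent in $\Lambda(M)$, and let $y$ be a vertex incident with $\sigma$ but not with $\tau$. If $x\sim y$ then $(x,y)(\tau)$ is either equal to $\sigma$ or adjacent to $\sigma$ in $\Lambda(M)$.
   Context: A finite lattice $(X,<)$ is ranked if there is $\rho:X\to\mathbb N$ such that for each $x$ every maximal chain from $\mathbf 0$ to $x$ has length $\rho(x)$. For a ranked lattice $L$ with top $\mathbf 1$, $\Lambda(L)$ is the graph on the elements of rank $\rho(\mathbf 1)-1$, with $\sigma\ne\gamma$ adjacent iff $\rho(\sigma\wedge\gamma)=\rho(\mathbf 1)-2$. A cellular pseudomanifold is a finite ranked lattice $M$ such that for all $x<z$: if $\rho(z)=\rho(x)+2$ there are exactly two $y$ with $x<y<z$, and if $\rho(z)>\rho(x)+2$ then $\Lambda([x,z])$ is connected. Faces are its elements, $\dim f=\rho(f)-1$; vertices are faces of dimension $0$ ($V(M)$ is the vertex set), facets are faces of dimension $\rho(\mathbf 1)-2$. A vertex $v$ is incident with a face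 $f$ if $v\le f$. The shadow $\mathrm{sh}(f)$ is the set of vertices $\le f$; a face is determined by its shadow, and faces are identified with their shadows. For vertices $x,y$, $(x,y)$ denotes the transposition of $x,y$ fixing all other vertices; $x\sim y$ iff $x=y$ or $(x,y)$ maps shadows of faces to shadows of faces (i.e. induces an automorphism of $M$). This is an equivalence relation. -}

module Defs where

open import Level using (0ℓ)
open import Data.Nat using (ℕ; zero; suc; _+_; _∸_; _<_)
open import Data.Fin using (Fin; _≟_)
open import Data.Fin.Subset using (Subset)
open import Data.Product using (Σ; ∃; _×_; _,_)
open import Data.Sum using (_⊎_)
open import Data.Empty using (⊥)
open import Relation.Nullary using (¬_; yes; no)
open import Relation.Binary using (Rel; Decidable)
open import Relation.Binary.PropositionalEquality using (_≡_; _≢_)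
open import Relation.Binary.Lattice.Structures using (IsBoundedLattice)
open import Function.Bundles using (_⇔_)

ExactlyTwo : ∀ {X : Set} → (X → Set) → Set
ExactlyTwo {X} P = Σ X λ y₁ → Σ X λ y₂ →
  y₁ ≢ y₂ × P y₁ × P y₂ × (∀ y → P y → y ≡ y₁ ⊎ y ≡ y₂)

data Walk {X : Set} (E : X → X → Set) : X → X → Set where
  []  : ∀ {a} → Walk E a a
  _∷_ : ∀ {a b c} → E a b → Walk E b c → Walk E a c

Connected : ∀ {X : Set} → (X → Set) → (X → X → Set) → Set
Connected {X} V E = ∀ a b → V a → V b → Walk E a b

module OrderNotions {X : Set} (_≤_ : Rel X 0ℓ) where

  _<ₒ_ : X → X → Set
  a <ₒ b = a ≤ b × a ≢ b

  _⋖_ : X → X → Set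
  a ⋖ b = a <ₒ b × (∀ z → a <ₒ z → z <ₒ b → ⊥)

  data MaxChain (a : X) : X → ℕ → Set where
    here : MaxChain a a zero
    step : ∀ {b c k} → MaxChain a b k → b ⋖ c → MaxChain a c (suc k)

record CellularPseudomanifold : Set₁ where
  field
    n    : ℕ
    _≤_  : Rel (Fin n) 0ℓ
    _≤?_ : Decidable _≤_
    _∨_  : Fin n → Fin n → Fin n
    _∧_  : Fin n → Fin n → Fin n
    𝟏    : Fin n
    𝟎    : Fin n
    isBoundedLattice : IsBoundedLattice _≡_ _≤_ _∨_ _∧_ 𝟏 𝟎

  open OrderNotions _≤_ public

  field
    ρ      : Fin n → ℕ
    ranked : ∀ x k → MaxChain 𝟎 x k → k ≡ ρ x

  -- Λ([x,z]): vertices are elements of [x,z] of rank ρ z - 1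
  -- (i.e. relative rank ρ([x,z]) - 1), adjacency: distinct with
  -- meet of rank ρ z - 2.
  ΛV : Fin n → Fin n → Fin n → Set
  ΛV x z w = x ≤ w × w ≤ z × ρ w ≡ ρ z ∸ 1

  ΛE : Fin n → Fin n → Fin n → Fin n → Set
  ΛE x z σ γ = ΛV x z σ × ΛV x z γ × σ ≢ γ × ρ (σ ∧ γ) ≡ ρ z ∸ 2

  field
    diamond   : ∀ x z → x <ₒ z → ρ z ≡ ρ x + 2 →
                ExactlyTwo (λ y → x <ₒ y × y <ₒ z)
    connected : ∀ x z → x <ₒ z → ρ x + 2 < ρ z →
                Connected (ΛV x z) (ΛE x z)

module CPM (M : CellularPseudomanifold) where
  open CellularPseudomanifold M public

  Face : Set
  Face = Fin n

  -- dim v = 0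
  IsVertex : Fin n → Set
  IsVertex v = ρ v ≡ 1

  -- dim f = ρ(𝟏) - 2
  IsFacet : Fin n → Set
  IsFacet f = ρ f ≡ ρ 𝟏 ∸ 1

  AdjΛ : Fin n → Fin n → Set
  AdjΛ σ γ = ΛE 𝟎 𝟏 σ γ

  sh : Face → Fin n → Set
  sh f v = IsVertex v × v ≤ f

  IsShadowOf : (Fin n → Set) → Face → Set
  IsShadowOf P f = ∀ v → P v ⇔ sh f v

  IsFaceShadow : (Fin n → Set) → Set
  IsFaceShadow P = Σ Face λ g → IsShadowOf P g

  swap : Fin n → Fin n → Fin n → Fin n
  swap x y v with v ≟ x
  ... | yes _ = y
  ... | no _ with v ≟ y
  ...   | yes _ = x
  ...   | no _ = v

  Image : (Fin n → Fin n) → (Fin n → Set) → Fin n → Set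
  Image φ P v = Σ (Fin n) λ u → P u × φ u ≡ v

  _∼_ : Fin n → Fin n → Set
  x ∼ y = x ≡ y ⊎ (∀ f → IsFaceShadow (Image (swap x y) (sh f)))

  Class : Fin n → Fin n → Set
  Class a v = IsVertex v × v ∼ a

  hat : Subset n → Fin n → Set
  hat U v = Σ (Fin n) λ a → IsVertex a × (∀ w → Class a w → w Data.Fin.Subset.∈ U) × Class a v

-- Ranks turn the diamond property into: an interval of length two has exactly
-- two interior elements. Hence every face is the join of its vertices (so a
-- face is determined by its shadow), and a vertex outside a face is avoided by
-- some facet containing that face. If x ∼ y, the transposition (x y) induces a
-- lattice automorphism φ fixing every face that contains both or neither of x, y.
--
-- (a) By induction on ρ t, every coatom of [𝟎, t] ∋ x, y meets {x, y}: walking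
-- in the connected graph Λ([𝟎, t]) from a coatom missing both to one containing
-- x, one crosses an edge τ τ′ with τ missing both and τ′ meeting {x, y}. Then
-- φ τ′ lies in the length-two interval [τ ∧ τ′, t], so it is τ or τ′; if say
-- x ∈ τ′ then y ∈ φ τ′, hence φ τ′ ≠ τ and τ′ = φ τ′ contains both x and y.
-- By induction the coatom τ ∧ τ′ of [𝟎, τ′] meets {x, y}, contradicting τ ⊇ τ ∧ τ′.
-- (d) is the same diamond argument in [σ ∧ τ, 𝟏].
-- (b) and the implication Û face ⇒ U face adjoin vertices one at a time: to add
-- z to a face α when some w ∼ z lies outside α, separate each other vertex u
-- from α ∪ {z} by a facet σ ⊇ α missing u; if z ∉ σ then w ∈ σ by (a), and
-- φ σ separates instead. Conversely, if U is the shadow of F, a vertex of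
-- U ∖ Û is separated from Û by the image of F under a transposition.

module Submission where

open import Defs
open import Data.Nat using (ℕ; zero; suc; _+_; _∸_; s≤s; z≤n) renaming (_<_ to _<ℕ_)
import Data.Nat.Properties as ℕ
open import Data.Fin using (Fin; _≟_)
open import Data.Fin.Properties using (any?; all?)
open import Data.Fin.Induction using (po-wellFounded; po-noetherian)
open import Data.Fin.Subset using (Subset; _∈_; _∉_)
open import Data.Fin.Subset.Properties using (_∈?_)
open import Data.List using (List; []; _∷_; foldr; filter; allFin)
import Data.List.Membership.Propositional as L
open import Data.List.Membership.Propositional.Properties using (∈-allFin; ∈-filter⁺; ∈-filter⁻)
open import Data.List.Relation.Unary.Any using (here; there)
open import Data.Product using (Σ; ∃; ∃₂; _×_; _,_; proj₁; proj₂; uncurry)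
open import Data.Sum using (_⊎_; inj₁; inj₂; [_,_]′)
import Data.Sum as Sum
open import Function using (_∘_; flip; id; case_of_)
open import Function.Bundles using (_⇔_; mk⇔; Equivalence)
open import Function.Properties.Equivalence using () renaming (refl to ⇔-refl; sym to ⇔-sym; trans to ⇔-trans)
open import Induction.WellFounded using (Acc; acc)
open import Relation.Binary using (Decidable)
open import Relation.Binary.Lattice.Structures using (IsBoundedLattice)
import Relation.Binary.Construct.NonStrictToStrict as NonStrictToStrict
open import Relation.Binary.PropositionalEquality using (_≡_; _≢_; refl; sym; trans; cong; subst; subst₂)
open import Relation.Nullary using (¬_; Dec; yes; no; ¬?; contradiction; contradiction₂)
open import Relation.Nullary.Decidable using (_×-dec_; _⊎-dec_; _→-dec_; map′; decidable-stable)
open import Relation.Unary using () renaming (Decidable to Decidable₁)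

open Equivalence using (to; from)

_⇔-dec_ : ∀ {A B : Set} → Dec A → Dec B → Dec (A ⇔ B)
A? ⇔-dec B? = map′ (λ (f , g) → mk⇔ f g) (λ e → to e , from e) ((A? →-dec B?) ×-dec (B? →-dec A?))

module _ {X : Set} {P : X → Set} where

  exactlyTwo-third : ExactlyTwo P → ∀ {a b c} → P a → P b → a ≢ b → P c → c ≡ a ⊎ c ≡ b
  exactlyTwo-third (y₁ , y₂ , _ , _ , _ , only) {a} {b} {c} pa pb a≢b pc
    with only a pa | only b pb | only c pc
  ... | inj₁ refl | inj₁ refl | _         = contradiction refl a≢b
  ... | inj₂ refl | inj₂ refl | _         = contradiction refl a≢b
  ... | inj₁ refl | inj₂ refl | inj₁ refl = inj₁ refl
  ... | inj₁ refl | inj₂ refl | inj₂ refl = inj₂ refl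
  ... | inj₂ refl | inj₁ refl | inj₁ refl = inj₂ refl
  ... | inj₂ refl | inj₁ refl | inj₂ refl = inj₁ refl

  exactlyTwo-other : ExactlyTwo P → ∀ {a} → P a → ∃ λ b → P b × b ≢ a
  exactlyTwo-other (y₁ , y₂ , y₁≢y₂ , p₁ , p₂ , only) {a} pa with only a pa
  ... | inj₁ refl = y₂ , p₂ , y₁≢y₂ ∘ sym
  ... | inj₂ refl = y₁ , p₁ , y₁≢y₂

walk-crossing : ∀ {X : Set} {E : X → X → Set} {Q : X → Set} → Decidable₁ Q →
                ∀ {a b} → Walk E a b → ¬ Q a → Q b → ∃₂ λ u w → E u w × ¬ Q u × Q w
walk-crossing Q? []                   ¬Qa Qb = contradiction Qb ¬Qa
walk-crossing Q? (_∷_ {a} {b} e walk) ¬Qa Qc with Q? b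
... | yes Qb = a , b , e , ¬Qa , Qb
... | no ¬Qb = walk-crossing Q? walk ¬Qb Qc

module Properties (M : CellularPseudomanifold) where
  open CPM M
  open IsBoundedLattice isBoundedLattice
    using (maximum; minimum; x≤x∨y; y≤x∨y; ∨-least; x∧y≤x; x∧y≤y; ∧-greatest; isPartialOrder)
    renaming (refl to ≤-refl; trans to ≤-trans; antisym to ≤-antisym; reflexive to ≤-reflexive)
  private
    module Strict = NonStrictToStrict _≡_ _≤_

  private variable
    a b c c′ f g t u v w x y z σ τ τ′ : Fin n

  <-trans : a <ₒ b → b <ₒ c → a <ₒ c
  <-trans = Strict.<-trans isPartialOrder

  _<?_ : Decidable _<ₒ_
  _<?_ = Strict.<-decidable _≟_ _≤?_

  cover-below : a <ₒ b → ∃ λ c → a ≤ c × c ⋖ b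
  cover-below {a} {b} = go (po-noetherian isPartialOrder a)
    where
    go : ∀ {a} → Acc (flip _<ₒ_) a → a <ₒ b → ∃ λ c → a ≤ c × c ⋖ b
    go {a} (acc rec) a<b with any? (λ z → (a <? z) ×-dec (z <? b))
    ... | yes (z , a<z , z<b) = let c , z≤c , c⋖b = go (rec a<z) z<b in c , ≤-trans (proj₁ a<z) z≤c , c⋖b
    ... | no ∄z = a , ≤-refl , a<b , λ z a<z z<b → ∄z (z , a<z , z<b)

  cover-above : a <ₒ b → ∃ λ c → a ⋖ c × c ≤ b
  cover-above {a} {b} = go (po-wellFounded isPartialOrder b)
    where
    go : ∀ {b} → Acc _<ₒ_ b → a <ₒ b → ∃ λ c → a ⋖ c × c ≤ b
    go {b} (acc rec) a<b with any? (λ z → (a <? z) ×-dec (z <? b))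
    ... | yes (z , a<z , z<b) = let c , a⋖c , c≤z = go (rec z<b) a<z in c , a⋖c , ≤-trans c≤z (proj₁ z<b)
    ... | no ∄z = b , (a<b , λ z a<z z<b → ∄z (z , a<z , z<b)) , ≤-refl

  ⋖-squeezeʳ : a ⋖ b → a <ₒ c → c ≤ b → c ≡ b
  ⋖-squeezeʳ {b = b} {c = c} (_ , nothing-between) a<c c≤b with c ≟ b
  ... | yes c≡b = c≡b
  ... | no c≢b  = contradiction (c≤b , c≢b) (nothing-between c a<c)

  ⋖-squeezeˡ : a ⋖ b → a ≤ c → c <ₒ b → c ≡ a
  ⋖-squeezeˡ {a = a} {c = c} (_ , nothing-between) a≤c c<b with c ≟ a
  ... | yes c≡a = c≡a
  ... | no c≢a  = contradiction c<b (nothing-between c (a≤c , c≢a ∘ sym))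

  𝟎<ₒ : x ≢ 𝟎 → 𝟎 <ₒ x
  𝟎<ₒ {x} x≢𝟎 = minimum x , x≢𝟎 ∘ sym

  <ₒ𝟏 : x ≢ 𝟏 → x <ₒ 𝟏
  <ₒ𝟏 {x} x≢𝟏 = maximum x , x≢𝟏

  join-of-⋖ : a ⋖ b → c ≤ b → ¬ c ≤ a → a ∨ c ≡ b
  join-of-⋖ {a} {b} {c} a⋖b c≤b c≰a =
    ⋖-squeezeʳ a⋖b (x≤x∨y a c , λ a≡a∨c → c≰a (subst (c ≤_) (sym a≡a∨c) (y≤x∨y a c)))
      (∨-least (proj₁ (proj₁ a⋖b)) c≤b)

  meet-of-⋖ : a ⋖ b → a ≤ c → ¬ b ≤ c → b ∧ c ≡ a
  meet-of-⋖ {a} {b} {c} a⋖b a≤c b≰c =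
    ⋖-squeezeˡ a⋖b (∧-greatest (proj₁ (proj₁ a⋖b)) a≤c)
      (x∧y≤x b c , λ b∧c≡b → b≰c (subst (_≤ c) b∧c≡b (x∧y≤y b c)))

  maxChain : ∀ x → ∃ (MaxChain 𝟎 x)
  maxChain x = go (po-wellFounded isPartialOrder x)
    where
    go : ∀ {x} → Acc _<ₒ_ x → ∃ (MaxChain 𝟎 x)
    go {x} (acc rec) with x ≟ 𝟎
    ... | yes refl = 0 , here
    ... | no x≢𝟎 = let c , _ , c⋖x = cover-below (𝟎<ₒ x≢𝟎)
                       k , chain = go (rec (proj₁ c⋖x))
                   in suc k , step chain c⋖x

  ρ-𝟎 : ρ 𝟎 ≡ 0
  ρ-𝟎 = sym (ranked 𝟎 0 here)

  ρ-⋖ : a ⋖ b → ρ b ≡ suc (ρ a)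
  ρ-⋖ {a} {b} a⋖b = let k , chain = maxChain a in
    trans (sym (ranked b (suc k) (step chain a⋖b))) (cong suc (ranked a k chain))

  ρ-<ₒ : a <ₒ b → ρ a <ℕ ρ b
  ρ-<ₒ {a} {b} = go (po-wellFounded isPartialOrder b)
    where
    go : ∀ {b} → Acc _<ₒ_ b → a <ₒ b → ρ a <ℕ ρ b
    go {b} (acc rec) a<b with cover-below a<b
    ... | c , a≤c , c⋖b rewrite ρ-⋖ c⋖b with a ≟ c
    ...   | yes refl = ℕ.n<1+n (ρ a)
    ...   | no a≢c   = ℕ.m<n⇒m<1+n (go (rec (proj₁ c⋖b)) (a≤c , a≢c))

  ≤∧ρ≡⇒≡ : a ≤ b → ρ a ≡ ρ b → a ≡ b
  ≤∧ρ≡⇒≡ {a} {b} a≤b ρa≡ρb with a ≟ b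
  ... | yes a≡b = a≡b
  ... | no a≢b  = contradiction ρa≡ρb (ℕ.<⇒≢ (ρ-<ₒ (a≤b , a≢b)))

  ≤∧ρ<⇒< : a ≤ b → ρ a <ℕ ρ b → a <ₒ b
  ≤∧ρ<⇒< a≤b ρa<ρb = a≤b , λ { refl → ℕ.<-irrefl refl ρa<ρb }

  -- Intervals of length two

  diamond-partner : a ⋖ b → b ⋖ c → ∃ λ b′ → (a <ₒ b′ × b′ <ₒ c) × b′ ≢ b
  diamond-partner {a} {b} {c} a⋖b b⋖c =
    exactlyTwo-other (diamond a c (<-trans (proj₁ a⋖b) (proj₁ b⋖c)) ρc≡ρa+2) (proj₁ a⋖b , proj₁ b⋖c)
    where
    ρc≡ρa+2 : ρ c ≡ ρ a + 2
    ρc≡ρa+2 = trans (ρ-⋖ b⋖c) (trans (cong suc (ρ-⋖ a⋖b)) (ℕ.+-comm 2 (ρ a)))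

  Middle : Fin n → Fin n → Fin n → Set
  Middle a b c = a ≤ c × c ≤ b × ρ c ≡ suc (ρ a)

  rank-two-interval : ρ b ≡ 2 + ρ a → Middle a b c → Middle a b c′ → c ≢ c′ →
                      Middle a b z → z ≡ c ⊎ z ≡ c′
  rank-two-interval {b} {a} ρb≡ mc mc′ c≢c′ mz =
    exactlyTwo-third (diamond a b (uncurry <-trans (between mc)) (trans ρb≡ (ℕ.+-comm 2 (ρ a))))
      (between mc) (between mc′) c≢c′ (between mz)
    where
    between : Middle a b z → a <ₒ z × z <ₒ b
    between (a≤z , z≤b , ρz≡) =
      ≤∧ρ<⇒< a≤z (subst (ρ a <ℕ_) (sym ρz≡) (ℕ.n<1+n (ρ a))) ,
      ≤∧ρ<⇒< z≤b (subst₂ _<ℕ_ (sym ρz≡) (sym ρb≡) (ℕ.n<1+n (suc (ρ a))))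

  Λ-edge-rank : ΛE 𝟎 t τ τ′ → ρ t ≡ 2 + ρ (τ ∧ τ′)
  Λ-edge-rank {t} {τ} {τ′} ((_ , _ , ρτ) , (_ , _ , ρτ′) , τ≢τ′ , ρτ∧τ′) =
    trans (rank≥2 (ρ t) (subst₂ _<ℕ_ ρτ∧τ′ ρτ (ρ-<ₒ τ∧τ′<τ))) (cong (2 +_) (sym ρτ∧τ′))
    where
    τ∧τ′<τ : (τ ∧ τ′) <ₒ τ
    τ∧τ′<τ = x∧y≤x τ τ′ , λ τ∧τ′≡τ →
      τ≢τ′ (≤∧ρ≡⇒≡ (subst (_≤ τ′) τ∧τ′≡τ (x∧y≤y τ τ′)) (trans ρτ (sym ρτ′)))
    rank≥2 : ∀ r → r ∸ 2 <ℕ r ∸ 1 → r ≡ 2 + (r ∸ 2)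
    rank≥2 (suc (suc r)) _ = refl

  Λ-edge-interval : ΛE 𝟎 t τ τ′ → (τ ∧ τ′) ≤ z → z ≤ t → ρ z ≡ ρ t ∸ 1 → z ≡ τ ⊎ z ≡ τ′
  Λ-edge-interval {t} {τ} {τ′} edge@((_ , τ≤t , ρτ) , (_ , τ′≤t , ρτ′) , τ≢τ′ , _) τ∧τ′≤z z≤t ρz =
    rank-two-interval ρt (x∧y≤x τ τ′ , τ≤t , below-top ρτ) (x∧y≤y τ τ′ , τ′≤t , below-top ρτ′) τ≢τ′
      (τ∧τ′≤z , z≤t , below-top ρz)
    where
    ρt : ρ t ≡ 2 + ρ (τ ∧ τ′)
    ρt = Λ-edge-rank edge
    below-top : ρ w ≡ ρ t ∸ 1 → ρ w ≡ suc (ρ (τ ∧ τ′))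
    below-top ρw = trans ρw (cong (_∸ 1) ρt)

  coatom-above : x <ₒ t → ∃ λ c → x ≤ c × ΛV 𝟎 t c
  coatom-above x<t = let c , x≤c , c⋖t = cover-below x<t in
    c , x≤c , minimum c , proj₁ (proj₁ c⋖t) , sym (cong (_∸ 1) (ρ-⋖ c⋖t))

  Λ-walk : 2 <ℕ ρ t → ΛV 𝟎 t σ → ΛV 𝟎 t τ → Walk (ΛE 𝟎 t) σ τ
  Λ-walk {t} {σ} {τ} 2<ρt =
    connected 𝟎 t (≤∧ρ<⇒< (minimum t) (subst (_<ℕ ρ t) (sym ρ-𝟎) (ℕ.<-trans (s≤s z≤n) 2<ρt)))
      (subst (λ r → r + 2 <ℕ ρ t) (sym ρ-𝟎) 2<ρt) σ τ

  Λ-edge-meet : ΛE 𝟎 t τ τ′ → ΛV 𝟎 τ′ (τ ∧ τ′)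
  Λ-edge-meet {t} {τ} {τ′} edge@(_ , (_ , _ , ρτ′) , _) =
    minimum _ , x∧y≤y τ τ′ , sym (cong (_∸ 1) (trans ρτ′ (cong (_∸ 1) (Λ-edge-rank edge))))

  -- Faces are joins of vertices; coatoms separate vertices from faces

  ≰-∧ˡ : ¬ v ≤ a → ¬ v ≤ (a ∧ b)
  ≰-∧ˡ {a = a} {b} v≰a v≤a∧b = v≰a (≤-trans v≤a∧b (x∧y≤x a b))

  ≰-∧ʳ : ¬ v ≤ b → ¬ v ≤ (a ∧ b)
  ≰-∧ʳ {b = b} {a} v≰b v≤a∧b = v≰b (≤-trans v≤a∧b (x∧y≤y a b))

  sh-𝟎 : ¬ sh 𝟎 v
  sh-𝟎 {v} (v-vertex , v≤𝟎) with ≤-antisym v≤𝟎 (minimum v)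
  ... | refl = contradiction (trans (sym v-vertex) ρ-𝟎) λ ()

  ≤-from-shadow : (∀ v → sh f v → v ≤ g) → f ≤ g
  ≤-from-shadow {f} {g} = go (po-wellFounded isPartialOrder f)
    where
    go : ∀ {f} → Acc _<ₒ_ f → (∀ v → sh f v → v ≤ g) → f ≤ g
    go {f} (acc rec) sh-f≤g with f ≟ 𝟎
    ... | yes refl = minimum g
    ... | no f≢𝟎 with cover-below (𝟎<ₒ f≢𝟎)
    ...   | c , _ , c⋖f with c ≟ 𝟎
    ...     | yes refl = sh-f≤g f (trans (ρ-⋖ c⋖f) (cong suc ρ-𝟎) , ≤-refl)
    ...     | no c≢𝟎 with cover-below (𝟎<ₒ c≢𝟎)
    ...       | d , _ , d⋖c with diamond-partner d⋖c c⋖f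
    ...         | c′ , (d<c′ , c′<f) , c′≢c =
                  subst (_≤ g) (join-of-⋖ c⋖f (proj₁ c′<f) c′≰c) (∨-least (below (proj₁ c⋖f)) (below c′<f))
      where
      below : ∀ {e} → e <ₒ f → e ≤ g
      below e<f = go (rec e<f) λ v (v-vertex , v≤e) → sh-f≤g v (v-vertex , ≤-trans v≤e (proj₁ e<f))
      c′≰c : ¬ c′ ≤ c
      c′≰c c′≤c = proj₂ d⋖c c′ d<c′ (c′≤c , c′≢c)

  shadow-injective : (∀ v → sh f v ⇔ sh g v) → f ≡ g
  shadow-injective f≈g = ≤-antisym (≤-from-shadow λ v s → proj₂ (to (f≈g v) s))
                                   (≤-from-shadow λ v s → proj₂ (from (f≈g v) s))

  IsFaceShadow-resp : {P Q : Fin n → Set} → (∀ v → P v ⇔ Q v) → IsFaceShadow P → IsFaceShadow Q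
  IsFaceShadow-resp P≈Q (g , P≈g) = g , λ v → ⇔-trans (⇔-sym (P≈Q v)) (P≈g v)

  coatom-avoiding : ¬ u ≤ f → ∃ λ σ → f ≤ σ × σ ⋖ 𝟏 × ¬ u ≤ σ
  coatom-avoiding {u} {f} = go (po-noetherian isPartialOrder f)
    where
    go : ∀ {f} → Acc (flip _<ₒ_) f → ¬ u ≤ f → ∃ λ σ → f ≤ σ × σ ⋖ 𝟏 × ¬ u ≤ σ
    go {f} (acc rec) u≰f with f ≟ 𝟏
    ... | yes refl = contradiction (maximum u) u≰f
    ... | no f≢𝟏 with cover-above (<ₒ𝟏 f≢𝟏)
    ...   | c , f⋖c , _ with c ≟ 𝟏
    ...     | yes refl = f , ≤-refl , f⋖c , u≰f
    ...     | no c≢𝟏 with cover-above (<ₒ𝟏 c≢𝟏)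
    ...       | e , c⋖e , _ with diamond-partner f⋖c c⋖e
    ...         | c′ , (f<c′ , c′<e) , c′≢c = [ climb (proj₁ f⋖c) , climb f<c′ ]′ u≰c⊎u≰c′
      where
      climb : ∀ {d} → f <ₒ d → ¬ u ≤ d → ∃ λ σ → f ≤ σ × σ ⋖ 𝟏 × ¬ u ≤ σ
      climb f<d u≰d = let σ , d≤σ , σ⋖𝟏 , u≰σ = go (rec f<d) u≰d in
                      σ , ≤-trans (proj₁ f<d) d≤σ , σ⋖𝟏 , u≰σ
      c≰c′ : ¬ c ≤ c′
      c≰c′ c≤c′ = proj₂ c⋖e c′ (c≤c′ , c′≢c ∘ sym) c′<e
      u≰c⊎u≰c′ : ¬ u ≤ c ⊎ ¬ u ≤ c′
      u≰c⊎u≰c′ with u ≤? c | u ≤? c′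
      ... | no u≰c  | _        = inj₁ u≰c
      ... | yes _   | no u≰c′  = inj₂ u≰c′
      ... | yes u≤c | yes u≤c′ =
        contradiction (subst (u ≤_) (meet-of-⋖ f⋖c (proj₁ f<c′) c≰c′) (∧-greatest u≤c u≤c′)) u≰f

  ⋁ : List (Fin n) → Fin n
  ⋁ = foldr _∨_ 𝟎

  ≤-⋁ : ∀ {vs} → v L.∈ vs → v ≤ ⋁ vs
  ≤-⋁ {vs = w ∷ vs} (here refl)  = x≤x∨y w (⋁ vs)
  ≤-⋁ {vs = w ∷ vs} (there v∈vs) = ≤-trans (≤-⋁ v∈vs) (y≤x∨y w (⋁ vs))

  ⋁-least : ∀ vs → (∀ {v} → v L.∈ vs → v ≤ g) → ⋁ vs ≤ g
  ⋁-least []       _   = minimum _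
  ⋁-least (w ∷ vs) ≤g = ∨-least (≤g (here refl)) (⋁-least vs (≤g ∘ there))

  separated⇒IsFaceShadow : (S : Fin n → Set) → Decidable₁ S → (∀ v → S v → IsVertex v) →
    (∀ u → IsVertex u → ¬ S u → ∃ λ h → (∀ v → S v → v ≤ h) × ¬ u ≤ h) → IsFaceShadow S
  separated⇒IsFaceShadow S S? S-vertices separate =
    ⋁ members , λ v → mk⇔ (λ Sv → S-vertices v Sv , ≤-⋁ (∈-filter⁺ S? (∈-allFin v) Sv)) (back v)
    where
    members : List (Fin n)
    members = filter S? (allFin n)
    back : ∀ v → sh (⋁ members) v → S v
    back v (v-vertex , v≤⋁) with S? v
    ... | yes Sv = Sv
    ... | no ¬Sv = let h , S≤h , v≰h = separate v v-vertex ¬Sv in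
      contradiction (≤-trans v≤⋁ (⋁-least members λ m → S≤h _ (proj₂ (∈-filter⁻ S? {xs = allFin n} m)))) v≰h

  data SwapView (x y v : Fin n) : Set where
    at-x : v ≡ x → SwapView x y v
    at-y : v ≡ y → SwapView x y v
    away : v ≢ x → v ≢ y → SwapView x y v

  swap-view : ∀ x y v → SwapView x y v
  swap-view x y v with v ≟ x | v ≟ y
  ... | yes v≡x | _       = at-x v≡x
  ... | no _    | yes v≡y = at-y v≡y
  ... | no v≢x  | no v≢y  = away v≢x v≢y

  swap-x : ∀ x y → swap x y x ≡ y
  swap-x x y with x ≟ x
  ... | yes _   = refl
  ... | no x≢x = contradiction refl x≢x

  swap-y : ∀ x y → swap x y y ≡ x
  swap-y x y with y ≟ x
  ... | yes y≡x = y≡x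
  ... | no _ with y ≟ y
  ...   | yes _   = refl
  ...   | no y≢y = contradiction refl y≢y

  swap-other : v ≢ x → v ≢ y → swap x y v ≡ v
  swap-other {v} {x} {y} v≢x v≢y with v ≟ x
  ... | yes v≡x = contradiction v≡x v≢x
  ... | no _ with v ≟ y
  ...   | yes v≡y = contradiction v≡y v≢y
  ...   | no _    = refl

  swap-involutive : ∀ x y v → swap x y (swap x y v) ≡ v
  swap-involutive x y v with swap-view x y v
  ... | at-x refl    = trans (cong (swap v y) (swap-x v y)) (swap-y v y)
  ... | at-y refl    = trans (cong (swap x v) (swap-y x v)) (swap-x x v)
  ... | away v≢x v≢y = trans (cong (swap x y) (swap-other v≢x v≢y)) (swap-other v≢x v≢y)

  swap-self : ∀ x v → swap x x v ≡ v
  swap-self x v with swap-view x x v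
  ... | at-x refl = swap-x v v
  ... | at-y refl = swap-x v v
  ... | away v≢x _ = swap-other v≢x v≢x

  swap-comm : ∀ x y v → swap x y v ≡ swap y x v
  swap-comm x y v with swap-view x y v
  ... | at-x refl    = trans (swap-x v y) (sym (swap-y y v))
  ... | at-y refl    = trans (swap-y x v) (sym (swap-x v x))
  ... | away v≢x v≢y = trans (swap-other v≢x v≢y) (sym (swap-other v≢y v≢x))

  swap-conjugate : x ≢ y → y ≢ z → x ≢ z → ∀ v → swap x y (swap y z (swap x y v)) ≡ swap x z v
  swap-conjugate {x} {y} {z} x≢y y≢z x≢z v with swap-view x y v
  ... | at-x refl
    rewrite swap-x v y | swap-x y z | swap-other (x≢z ∘ sym) (y≢z ∘ sym) | swap-x v z = refl
  ... | at-y refl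
    rewrite swap-y x v | swap-other (x≢y) x≢z | swap-x x v | swap-other (x≢y ∘ sym) y≢z = refl
  ... | away v≢x v≢y with v ≟ z
  ...   | yes refl
    rewrite swap-other v≢x v≢y | swap-y y v | swap-y x y | swap-y x v = refl
  ...   | no v≢z
    rewrite swap-other v≢x v≢y | swap-other v≢y v≢z | swap-other v≢x v≢y | swap-other v≢x v≢z = refl

  swap-vertex : IsVertex x → IsVertex y → IsVertex v → IsVertex (swap x y v)
  swap-vertex {x} {y} {v} x-vertex y-vertex v-vertex with swap-view x y v
  ... | at-x refl    = subst IsVertex (sym (swap-x v y)) y-vertex
  ... | at-y refl    = subst IsVertex (sym (swap-y x v)) x-vertex
  ... | away v≢x v≢y = subst IsVertex (sym (swap-other v≢x v≢y)) v-vertex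

  Image-swap : {P : Fin n → Set} → Image (swap x y) P v ⇔ P (swap x y v)
  Image-swap {x} {y} {v} {P} = mk⇔
    (λ (u , Pu , su≡v) → subst P (trans (sym (swap-involutive x y u)) (cong (swap x y) su≡v)) Pu)
    (λ P[sv] → swap x y v , P[sv] , swap-involutive x y v)

  -- Preimages rather than images, so that composition is immediate; for the
  -- involution swap x y the two notions agree.
  PreservesFaces : (Fin n → Fin n) → Set
  PreservesFaces s = ∀ f → ∃ λ g → ∀ v → sh g v ⇔ sh f (s v)

  preservesFaces-resp : ∀ {s s′} → (∀ v → s v ≡ s′ v) → PreservesFaces s → PreservesFaces s′
  preservesFaces-resp s≗s′ preserves f =
    let g , g≈ = preserves f in g , λ v → subst (λ w → sh g v ⇔ sh f w) (s≗s′ v) (g≈ v)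

  preservesFaces-∘ : ∀ {s s′} → PreservesFaces s → PreservesFaces s′ → PreservesFaces (s ∘ s′)
  preservesFaces-∘ {s} {s′} preserves preserves′ f =
    let g , g≈ = preserves f ; h , h≈ = preserves′ g in h , λ v → ⇔-trans (h≈ v) (g≈ (s′ v))

  ∼⇒preservesFaces : x ∼ y → PreservesFaces (swap x y)
  ∼⇒preservesFaces {x} (inj₁ refl) = preservesFaces-resp (sym ∘ swap-self x) λ f → f , λ _ → ⇔-refl
  ∼⇒preservesFaces (inj₂ images) f = let g , image≈g = images f in g , λ v → ⇔-trans (⇔-sym (image≈g v)) Image-swap

  preservesFaces⇒∼ : PreservesFaces (swap x y) → x ∼ y
  preservesFaces⇒∼ preserves = inj₂ λ f → let g , g≈ = preserves f in g , λ v → ⇔-trans Image-swap (⇔-sym (g≈ v))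

  ∼-sym : x ∼ y → y ∼ x
  ∼-sym {x} {y} x∼y = preservesFaces⇒∼ (preservesFaces-resp (swap-comm x y) (∼⇒preservesFaces x∼y))

  ∼-trans : x ∼ y → y ∼ z → x ∼ z
  ∼-trans {x} {y} {z} x∼y y∼z with x ≟ z | x ≟ y | y ≟ z
  ... | yes x≡z | _        | _        = inj₁ x≡z
  ... | no _    | yes refl | _        = y∼z
  ... | no _    | no _     | yes refl = x∼y
  ... | no x≢z  | no x≢y   | no y≢z   = preservesFaces⇒∼ (preservesFaces-resp (swap-conjugate x≢y y≢z x≢z)
      (preservesFaces-∘ (∼⇒preservesFaces x∼y) (preservesFaces-∘ (∼⇒preservesFaces y∼z) (∼⇒preservesFaces x∼y))))

  sh? : ∀ f → Decidable₁ (sh f)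
  sh? f v = (ρ v ℕ.≟ 1) ×-dec (v ≤? f)

  _∼?_ : Decidable _∼_
  x ∼? y = (x ≟ y) ⊎-dec all? λ f → any? λ g → all? λ v →
    any? (λ u → sh? f u ×-dec (swap x y u ≟ v)) ⇔-dec sh? g v

  Class? : ∀ a → Decidable₁ (Class a)
  Class? a v = (ρ v ℕ.≟ 1) ×-dec (v ∼? a)

  hat? : ∀ U → Decidable₁ (hat U)
  hat? U v = any? λ a → (ρ a ℕ.≟ 1) ×-dec all? (λ w → Class? a w →-dec (w ∈? U)) ×-dec Class? a v

  -- The lattice automorphism induced by a transposition

  module SwapAutomorphism (x-vertex : IsVertex x) (y-vertex : IsVertex y) (preserves : PreservesFaces (swap x y)) where

    φ : Fin n → Fin n
    φ f = proj₁ (preserves f)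

    ≤φ⇔ : IsVertex v → v ≤ φ f ⇔ swap x y v ≤ f
    ≤φ⇔ {v} {f} v-vertex = mk⇔
      (λ v≤φf → proj₂ (to (proj₂ (preserves f) v) (v-vertex , v≤φf)))
      (λ sv≤f → proj₂ (from (proj₂ (preserves f) v) (swap-vertex x-vertex y-vertex v-vertex , sv≤f)))

    x≤φ⇔y≤ : x ≤ φ f ⇔ y ≤ f
    x≤φ⇔y≤ {f} = subst (λ w → x ≤ φ f ⇔ w ≤ f) (swap-x x y) (≤φ⇔ x-vertex)

    y≤φ⇔x≤ : y ≤ φ f ⇔ x ≤ f
    y≤φ⇔x≤ {f} = subst (λ w → y ≤ φ f ⇔ w ≤ f) (swap-y x y) (≤φ⇔ y-vertex)

    away-≤φ⇔ : IsVertex v → v ≢ x → v ≢ y → v ≤ φ f ⇔ v ≤ f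
    away-≤φ⇔ {v} {f} v-vertex v≢x v≢y = subst (λ w → v ≤ φ f ⇔ w ≤ f) (swap-other v≢x v≢y) (≤φ⇔ v-vertex)

    φ-mono : a ≤ b → φ a ≤ φ b
    φ-mono a≤b = ≤-from-shadow λ v (v-vertex , v≤φa) →
      from (≤φ⇔ v-vertex) (≤-trans (to (≤φ⇔ v-vertex) v≤φa) a≤b)

    φ-involutive : ∀ f → φ (φ f) ≡ f
    φ-involutive f = shadow-injective λ v → mk⇔
      (λ (v-vertex , v≤φφf) → v-vertex , subst (_≤ f) (swap-involutive x y v)
         (to (≤φ⇔ (swap-vertex x-vertex y-vertex v-vertex)) (to (≤φ⇔ v-vertex) v≤φφf)))
      (λ (v-vertex , v≤f) → v-vertex , from (≤φ⇔ v-vertex) (from (≤φ⇔ (swap-vertex x-vertex y-vertex v-vertex))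
         (subst (_≤ f) (sym (swap-involutive x y v)) v≤f)))

    φ-injective : φ a ≡ φ b → a ≡ b
    φ-injective {a} {b} φa≡φb = trans (sym (φ-involutive a)) (trans (cong φ φa≡φb) (φ-involutive b))

    φ-adjoint : a ≤ φ b → φ a ≤ b
    φ-adjoint {a} {b} a≤φb = subst (φ a ≤_) (φ-involutive b) (φ-mono a≤φb)

    φ-<ₒ : a <ₒ b → φ a <ₒ φ b
    φ-<ₒ (a≤b , a≢b) = φ-mono a≤b , a≢b ∘ φ-injective

    φ-⋖ : a ⋖ b → φ a ⋖ φ b
    φ-⋖ {a} {b} (a<b , nothing-between) = φ-<ₒ a<b , λ z φa<z z<φb → nothing-between (φ z)
      (subst (_<ₒ φ z) (φ-involutive a) (φ-<ₒ φa<z)) (subst (φ z <ₒ_) (φ-involutive b) (φ-<ₒ z<φb))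

    φ-𝟎 : φ 𝟎 ≡ 𝟎
    φ-𝟎 = ≤-antisym (≤-from-shadow λ v (v-vertex , v≤φ𝟎) →
      contradiction (swap-vertex x-vertex y-vertex v-vertex , to (≤φ⇔ v-vertex) v≤φ𝟎) sh-𝟎) (minimum _)

    φ-maxChain : ∀ {f k} → MaxChain 𝟎 f k → MaxChain 𝟎 (φ f) k
    φ-maxChain here             = subst (λ z → MaxChain 𝟎 z 0) (sym φ-𝟎) here
    φ-maxChain (step chain c⋖f) = step (φ-maxChain chain) (φ-⋖ c⋖f)

    ρ-φ : ∀ f → ρ (φ f) ≡ ρ f
    ρ-φ f = let k , chain = maxChain f in trans (sym (ranked (φ f) k (φ-maxChain chain))) (ranked f k chain)

    φ-∧ : ∀ a b → φ (a ∧ b) ≡ φ a ∧ φ b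
    φ-∧ a b = ≤-antisym (∧-greatest (φ-mono (x∧y≤x a b)) (φ-mono (x∧y≤y a b)))
      (subst (_≤ φ (a ∧ b)) (φ-involutive _)
        (φ-mono (∧-greatest (φ-adjoint (x∧y≤x (φ a) (φ b))) (φ-adjoint (x∧y≤y (φ a) (φ b))))))

    φ-fixes : (∀ v → IsVertex v → v ≤ f → swap x y v ≤ f) → φ f ≡ f
    φ-fixes {f} closed = shadow-injective λ v → mk⇔
      (λ (v-vertex , v≤φf) → v-vertex , subst (_≤ f) (swap-involutive x y v)
         (closed _ (swap-vertex x-vertex y-vertex v-vertex) (to (≤φ⇔ v-vertex) v≤φf)))
      (λ (v-vertex , v≤f) → v-vertex , from (≤φ⇔ v-vertex) (closed v v-vertex v≤f))

    φ-fixes-both : x ≤ f → y ≤ f → φ f ≡ f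
    φ-fixes-both {f} x≤f y≤f = φ-fixes λ v _ v≤f → case swap-view x y v of λ where
      (at-x refl)    → subst (_≤ f) (sym (swap-x v y)) y≤f
      (at-y refl)    → subst (_≤ f) (sym (swap-y x v)) x≤f
      (away v≢x v≢y) → subst (_≤ f) (sym (swap-other v≢x v≢y)) v≤f

    φ-fixes-neither : ¬ x ≤ f → ¬ y ≤ f → φ f ≡ f
    φ-fixes-neither {f} x≰f y≰f = φ-fixes λ v _ v≤f → case swap-view x y v of λ where
      (at-x refl)    → contradiction v≤f x≰f
      (at-y refl)    → contradiction v≤f y≰f
      (away v≢x v≢y) → subst (_≤ f) (sym (swap-other v≢x v≢y)) v≤f

    φ-AdjΛ : AdjΛ σ τ → AdjΛ (φ σ) (φ τ)
    φ-AdjΛ {σ} {τ} ((_ , _ , ρσ) , (_ , _ , ρτ) , σ≢τ , ρσ∧τ) =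
      (minimum _ , maximum _ , trans (ρ-φ σ) ρσ) , (minimum _ , maximum _ , trans (ρ-φ τ) ρτ) ,
      σ≢τ ∘ φ-injective , trans (cong ρ (sym (φ-∧ σ τ))) (trans (ρ-φ (σ ∧ τ)) ρσ∧τ)

    Λ-edge-φ : ΛE 𝟎 t τ τ′ → x ≤ t → y ≤ t → ¬ x ≤ (τ ∧ τ′) → ¬ y ≤ (τ ∧ τ′) → φ τ′ ≡ τ ⊎ φ τ′ ≡ τ′
    Λ-edge-φ {t} {τ} {τ′} edge@(_ , (_ , τ′≤t , ρτ′) , _) x≤t y≤t x≰τ∧τ′ y≰τ∧τ′ =
      Λ-edge-interval edge
        (subst (_≤ φ τ′) (φ-fixes-neither x≰τ∧τ′ y≰τ∧τ′) (φ-mono (x∧y≤y τ τ′)))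
        (subst (φ τ′ ≤_) (φ-fixes-both x≤t y≤t) (φ-mono τ′≤t))
        (trans (ρ-φ τ′) ρτ′)

    Λ-edge-contains-pair : ΛE 𝟎 t τ τ′ → x ≤ t → y ≤ t → ¬ x ≤ τ → ¬ y ≤ τ → x ≤ τ′ ⊎ y ≤ τ′ → x ≤ τ′ × y ≤ τ′
    Λ-edge-contains-pair {t} {τ} {τ′} edge x≤t y≤t x≰τ y≰τ =
      [ (λ x≤τ′ → x≤τ′ , settle (from y≤φ⇔x≤ x≤τ′) y≰τ) , (λ y≤τ′ → settle (from x≤φ⇔y≤ y≤τ′) x≰τ , y≤τ′) ]′
      where
      settle : v ≤ φ τ′ → ¬ v ≤ τ → v ≤ τ′
      settle {v} v≤φτ′ v≰τ with Λ-edge-φ edge x≤t y≤t (≰-∧ˡ x≰τ) (≰-∧ˡ y≰τ)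
      ... | inj₁ φτ′≡τ  = contradiction (subst (v ≤_) φτ′≡τ v≤φτ′) v≰τ
      ... | inj₂ φτ′≡τ′ = subst (v ≤_) φτ′≡τ′ v≤φτ′

    module _ (x≢y : x ≢ y) where

      coatom-meets-pair-step : ∀ {m} →
                               (∀ {t σ} → ρ t ≡ suc (suc m) → x ≤ t → y ≤ t → ΛV 𝟎 t σ → x ≤ σ ⊎ y ≤ σ) →
                               ρ t ≡ suc (suc (suc m)) → x ≤ t → y ≤ t → ΛV 𝟎 t σ → x ≤ σ ⊎ y ≤ σ
      coatom-meets-pair-step {t} {σ} meets ρt x≤t y≤t σ∈Λ with x ≤? σ | y ≤? σ
      ... | yes x≤σ | _       = inj₁ x≤σ
      ... | no _    | yes y≤σ = inj₂ y≤σ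
      ... | no x≰σ  | no y≰σ  =
        let c , x≤c , c∈Λ = coatom-above (≤∧ρ<⇒< x≤t (subst₂ _<ℕ_ (sym x-vertex) (sym ρt) (s≤s (s≤s z≤n))))
            walk = Λ-walk (subst (2 <ℕ_) (sym ρt) (s≤s (s≤s (s≤s z≤n)))) σ∈Λ c∈Λ
            τ , τ′ , edge , τ∉ , τ′∈ = walk-crossing (λ z → (x ≤? z) ⊎-dec (y ≤? z)) walk [ x≰σ , y≰σ ]′ (inj₁ x≤c)
            (_ , (_ , _ , ρτ′) , _) = edge
            x≤τ′ , y≤τ′ = Λ-edge-contains-pair edge x≤t y≤t (τ∉ ∘ inj₁) (τ∉ ∘ inj₂) τ′∈
            τ∧τ′-meets = meets (trans ρτ′ (cong (_∸ 1) ρt)) x≤τ′ y≤τ′ (Λ-edge-meet edge)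
        in contradiction₂ τ∧τ′-meets (≰-∧ˡ (τ∉ ∘ inj₁)) (≰-∧ˡ (τ∉ ∘ inj₂))

      coatom-meets-pair : ∀ k → ρ t ≡ k → x ≤ t → y ≤ t → ΛV 𝟎 t σ → x ≤ σ ⊎ y ≤ σ
      coatom-meets-pair {t} zero ρt x≤t _ _ =
        contradiction (x-vertex , subst (x ≤_) (sym (≤∧ρ≡⇒≡ (minimum t) (trans ρ-𝟎 (sym ρt)))) x≤t) sh-𝟎
      coatom-meets-pair {t} (suc zero) ρt x≤t y≤t _ =
        contradiction (trans (≤∧ρ≡⇒≡ x≤t (trans x-vertex (sym ρt))) (sym (≤∧ρ≡⇒≡ y≤t (trans y-vertex (sym ρt)))))
          x≢y
      coatom-meets-pair {t} {σ} 2 ρt x≤t y≤t (_ , σ≤t , ρσ) =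
        Sum.map (≤-reflexive ∘ sym) (≤-reflexive ∘ sym)
          (rank-two-interval (trans ρt (cong (2 +_) (sym ρ-𝟎))) (atom x-vertex x≤t) (atom y-vertex y≤t) x≢y
            (atom (trans ρσ (cong (_∸ 1) ρt)) σ≤t))
        where
        atom : IsVertex v → v ≤ t → Middle 𝟎 t v
        atom {v} v-vertex v≤t = minimum v , v≤t , trans v-vertex (cong suc (sym ρ-𝟎))
      coatom-meets-pair (suc (suc (suc m))) = coatom-meets-pair-step (coatom-meets-pair (suc (suc m)))

      facet-meets-pair : IsFacet σ → x ≤ σ ⊎ y ≤ σ
      facet-meets-pair {σ} σ-facet =
        coatom-meets-pair (ρ 𝟏) refl (maximum x) (maximum y) (minimum σ , maximum σ , σ-facet)

    φ-neighbour : AdjΛ σ τ → y ≤ σ → ¬ y ≤ τ → φ τ ≡ σ ⊎ AdjΛ σ (φ τ)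
    φ-neighbour {σ} {τ} adj@(_ , (_ , _ , τ-facet) , _) y≤σ y≰τ with x ≤? σ
    ... | yes x≤σ = inj₂ (subst (λ s → AdjΛ s (φ τ)) (φ-fixes-both x≤σ y≤σ) (φ-AdjΛ adj))
    ... | no x≰σ
      with Λ-edge-φ adj (maximum x) (maximum y) (≰-∧ˡ x≰σ) (≰-∧ʳ y≰τ)
    ...   | inj₁ φτ≡σ = inj₁ φτ≡σ
    ...   | inj₂ φτ≡τ = contradiction (subst (y ≤_) φτ≡τ (from y≤φ⇔x≤ x≤τ)) y≰τ
      where
      x≤τ : x ≤ τ
      x≤τ = [ id , flip contradiction y≰τ ]′ (facet-meets-pair (λ { refl → x≰σ y≤σ }) τ-facet)

  ∼-meets-facets : IsVertex x → IsVertex y → x ≢ y → x ∼ y → IsFacet σ → x ≤ σ ⊎ y ≤ σ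
  ∼-meets-facets x-vertex y-vertex x≢y x∼y =
    SwapAutomorphism.facet-meets-pair x-vertex y-vertex (∼⇒preservesFaces x∼y) x≢y

  -- Adjoining vertices to faces

  adjoin-vertex : IsVertex z → IsVertex w → z ≢ w → PreservesFaces (swap z w) → ¬ z ≤ f → ¬ w ≤ f →
                  IsFaceShadow (λ v → sh f v ⊎ v ≡ z)
  adjoin-vertex {z} {w} {f} z-vertex w-vertex z≢w preserves z≰f w≰f =
    separated⇒IsFaceShadow _ (λ v → sh? f v ⊎-dec (v ≟ z))
      (λ { v (inj₁ (v-vertex , _)) → v-vertex ; v (inj₂ refl) → z-vertex }) separate
    where
    open SwapAutomorphism z-vertex w-vertex preserves
    separate : ∀ u → IsVertex u → ¬ (sh f u ⊎ u ≡ z) → ∃ λ h → (∀ v → sh f v ⊎ v ≡ z → v ≤ h) × ¬ u ≤ h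
    separate u u-vertex u∉ with coatom-avoiding (λ u≤f → u∉ (inj₁ (u-vertex , u≤f)))
    ... | σ , f≤σ , σ⋖𝟏 , u≰σ with z ≤? σ
    ...   | yes z≤σ = σ , (λ { v (inj₁ (_ , v≤f)) → ≤-trans v≤f f≤σ ; v (inj₂ refl) → z≤σ }) , u≰σ
    ...   | no z≰σ = φ σ , (λ { v (inj₁ v∈f) → inherited v∈f ; v (inj₂ refl) → from x≤φ⇔y≤ w≤σ }) , u≰φσ
      where
      w≤σ : w ≤ σ
      w≤σ = [ flip contradiction z≰σ , id ]′ (facet-meets-pair z≢w (sym (cong (_∸ 1) (ρ-⋖ σ⋖𝟏))))
      inherited : sh f v → v ≤ φ σ
      inherited (v-vertex , v≤f) =
        from (away-≤φ⇔ v-vertex (λ { refl → z≰f v≤f }) (λ { refl → w≰f v≤f })) (≤-trans v≤f f≤σ)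
      u≰φσ : ¬ u ≤ φ σ
      u≰φσ = u≰σ ∘ to (away-≤φ⇔ u-vertex (u∉ ∘ inj₂) (λ { refl → u≰σ w≤σ }))

  module _ {P T : Fin n → Set} (P? : Decidable₁ P) (T? : Decidable₁ T) (T-vertices : ∀ v → T v → IsVertex v)
           (partner : ∀ z → T z → ∃ λ w → IsVertex w × z ≢ w × PreservesFaces (swap z w) × ¬ P w × ¬ T w) where

    private
      Grown : List (Fin n) → Fin n → Set
      Grown []       v = P v
      Grown (z ∷ zs) v = Grown zs v ⊎ (v ≡ z × T v)

      Grown? : ∀ zs → Decidable₁ (Grown zs)
      Grown? []       = P?
      Grown? (z ∷ zs) v = Grown? zs v ⊎-dec ((v ≟ z) ×-dec T? v)

      Grown⊆ : ∀ zs → Grown zs v → P v ⊎ T v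
      Grown⊆ []       Pv               = inj₁ Pv
      Grown⊆ (z ∷ zs) (inj₁ grown)     = Grown⊆ zs grown
      Grown⊆ (z ∷ zs) (inj₂ (_ , Tv)) = inj₂ Tv

      P⊆Grown : ∀ zs → P v → Grown zs v
      P⊆Grown []       Pv = Pv
      P⊆Grown (z ∷ zs) Pv = inj₁ (P⊆Grown zs Pv)

      T⊆Grown : ∀ {zs} → v L.∈ zs → T v → Grown zs v
      T⊆Grown (here refl)  Tv = inj₂ (refl , Tv)
      T⊆Grown (there v∈zs) Tv = inj₁ (T⊆Grown v∈zs Tv)

      grow : IsFaceShadow P → ∀ zs → IsFaceShadow (Grown zs)
      grow P-face []       = P-face
      grow P-face (z ∷ zs) with Grown? zs z | T? z
      ... | yes z-grown | _ =
        IsFaceShadow-resp (λ v → mk⇔ inj₁ [ id , (λ { (refl , _) → z-grown }) ]′) (grow P-face zs)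
      ... | no _ | no ¬Tz =
        IsFaceShadow-resp (λ v → mk⇔ inj₁ [ id , (λ { (refl , Tz) → contradiction Tz ¬Tz }) ]′) (grow P-face zs)
      ... | no z∉ | yes Tz =
        let w , w-vertex , z≢w , preserves , ¬Pw , ¬Tw = partner z Tz
            α , α≈ = grow P-face zs
            z-vertex = T-vertices z Tz
        in IsFaceShadow-resp (λ v → mk⇔ (Sum.map (from (α≈ v)) λ { refl → refl , Tz }) (Sum.map (to (α≈ v)) proj₁))
             (adjoin-vertex z-vertex w-vertex z≢w preserves (z∉ ∘ from (α≈ z) ∘ (z-vertex ,_))
               ([ ¬Pw , ¬Tw ]′ ∘ Grown⊆ zs ∘ from (α≈ w) ∘ (w-vertex ,_)))

    adjoin-vertices : IsFaceShadow P → IsFaceShadow (λ v → P v ⊎ T v)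
    adjoin-vertices P-face = IsFaceShadow-resp
      (λ v → mk⇔ (Grown⊆ (allFin n)) [ P⊆Grown (allFin n) , T⊆Grown (∈-allFin v) ]′) (grow P-face (allFin n))

  adjoin-proper-subclass : ∀ {a α} (B : Subset n) → (∀ v → sh α v → ¬ Class a v) → (∀ v → v ∈ B → Class a v) →
                           (∃ λ v → Class a v × v ∉ B) → IsFaceShadow (λ v → sh α v ⊎ v ∈ B)
  adjoin-proper-subclass {a} {α} B α∩A≡∅ B⊆A (w , w∈A@(w-vertex , w∼a) , w∉B) =
    adjoin-vertices (sh? α) (_∈? B) (λ v → proj₁ ∘ B⊆A v) partner (α , λ _ → ⇔-refl)
    where
    partner : ∀ z → z ∈ B → ∃ λ w → IsVertex w × z ≢ w × PreservesFaces (swap z w) × ¬ sh α w × w ∉ B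
    partner z z∈B = w , w-vertex , (λ { refl → w∉B z∈B }) ,
      ∼⇒preservesFaces (∼-trans (proj₂ (B⊆A z z∈B)) (∼-sym w∼a)) , (λ w∈α → α∩A≡∅ w w∈α w∈A) , w∉B

  module _ (U : Subset n) where

    hat⊆ : hat U v → v ∈ U
    hat⊆ {v} (_ , _ , A⊆U , v∈A) = A⊆U v v∈A

    hat-vertex : hat U v → IsVertex v
    hat-vertex (_ , _ , _ , v-vertex , _) = v-vertex

    class-escapes : IsVertex z → ¬ hat U z → ∃ λ w → Class z w × w ∉ U
    class-escapes {z} z-vertex z∉hat with any? (λ w → Class? z w ×-dec ¬? (w ∈? U))
    ... | yes escape = escape
    ... | no ∄escape = contradiction (z , z-vertex , A⊆U , z-vertex , inj₁ refl) z∉hat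
      where
      A⊆U : ∀ w → Class z w → w ∈ U
      A⊆U w w∈A = decidable-stable (w ∈? U) λ w∉U → ∄escape (w , w∈A , w∉U)

    hat-isFaceShadow : IsFaceShadow (_∈ U) → IsFaceShadow (hat U)
    hat-isFaceShadow (F , U≈F) = separated⇒IsFaceShadow (hat U) (hat? U) (λ _ → hat-vertex) separate
      where
      separate : ∀ u → IsVertex u → ¬ hat U u → ∃ λ h → (∀ v → hat U v → v ≤ h) × ¬ u ≤ h
      separate u u-vertex u∉hat with u ∈? U
      ... | no u∉U = F , (λ v → proj₂ ∘ to (U≈F v) ∘ hat⊆) , u∉U ∘ from (U≈F u) ∘ (u-vertex ,_)
      -- u shares its class with some w ∉ U; swapping u and w moves F off u and keeps Û.
      ... | yes u∈U =
        let w , (w-vertex , w∼u) , w∉U = class-escapes u-vertex u∉hat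
            open SwapAutomorphism u-vertex w-vertex (∼⇒preservesFaces (∼-sym w∼u))
            inherited : ∀ v → hat U v → v ≤ φ F
            inherited v v∈hat =
              from (away-≤φ⇔ (hat-vertex v∈hat) (λ { refl → u∉hat v∈hat })
                                                (λ v≡w → w∉U (subst (_∈ U) v≡w (hat⊆ v∈hat))))
                   (proj₂ (to (U≈F v) (hat⊆ v∈hat)))
        in φ F , inherited , w∉U ∘ from (U≈F w) ∘ (w-vertex ,_) ∘ to x≤φ⇔y≤

    isFaceShadow-from-hat : (∀ v → v ∈ U → IsVertex v) → IsFaceShadow (hat U) → IsFaceShadow (_∈ U)
    isFaceShadow-from-hat U-vertices hat-face =
      IsFaceShadow-resp (λ v → mk⇔ [ hat⊆ , proj₁ ]′ (back v))
        (adjoin-vertices (hat? U) T? (λ v → U-vertices v ∘ proj₁) partner hat-face)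
      where
      T : Fin n → Set
      T v = v ∈ U × ¬ hat U v
      T? : Decidable₁ T
      T? v = (v ∈? U) ×-dec ¬? (hat? U v)
      partner : ∀ z → T z → ∃ λ w → IsVertex w × z ≢ w × PreservesFaces (swap z w) × ¬ hat U w × ¬ T w
      partner z (z∈U , z∉hat) =
        let w , (w-vertex , w∼z) , w∉U = class-escapes (U-vertices z z∈U) z∉hat in
        w , w-vertex , (λ z≡w → w∉U (subst (_∈ U) z≡w z∈U)) , ∼⇒preservesFaces (∼-sym w∼z) , w∉U ∘ hat⊆ , w∉U ∘ proj₁
      back : ∀ v → v ∈ U → hat U v ⊎ T v
      back v v∈U with hat? U v
      ... | yes v∈hat = inj₁ v∈hat
      ... | no v∉hat  = inj₂ (v∈U , v∉hat)

  transposed-neighbour : AdjΛ σ τ → IsVertex x → IsVertex y → y ≤ σ → ¬ y ≤ τ → x ∼ y →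
                         ∀ g → IsShadowOf (Image (swap x y) (sh τ)) g → g ≡ σ ⊎ AdjΛ σ g
  transposed-neighbour {σ} {τ} {x} {y} adj x-vertex y-vertex y≤σ y≰τ x∼y g image≈g =
    subst (λ h → h ≡ σ ⊎ AdjΛ σ h) (sym g≡φτ) (φ-neighbour adj y≤σ y≰τ)
    where
    preserves : PreservesFaces (swap x y)
    preserves = ∼⇒preservesFaces x∼y
    open SwapAutomorphism x-vertex y-vertex preserves
    g≡φτ : g ≡ φ τ
    g≡φτ = shadow-injective λ v →
      ⇔-trans (⇔-sym (image≈g v)) (⇔-trans Image-swap (⇔-sym (proj₂ (preserves τ) v)))

lemma4p2 : (M : CellularPseudomanifold) → let open CPM M in
  -- (a)
  (∀ x y → IsVertex x → IsVertex y → x ≢ y → x ∼ y →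
     ∀ σ → IsFacet σ → x ≤ σ ⊎ y ≤ σ)
  ×
  -- (b)  A = class of the vertex a
  (∀ a → IsVertex a → ∀ (α : Face) → (∀ v → sh α v → ¬ Class a v) →
     ∀ (B : Subset n) → (∀ v → v ∈ B → Class a v) →
     Σ (Fin n) (λ v → Class a v × v ∉ B) →
     IsFaceShadow (λ v → sh α v ⊎ v ∈ B))
  ×
  -- (c)
  (∀ (U : Subset n) → (∀ v → v ∈ U → IsVertex v) →
     IsFaceShadow (λ v → v ∈ U) ⇔ IsFaceShadow (hat U))
  ×
  -- (d)
  (∀ σ τ → IsFacet σ → IsFacet τ → AdjΛ σ τ →
     ∀ x y → IsVertex x → IsVertex y → y ≤ σ → ¬ (y ≤ τ) → x ∼ y →
     ∀ g → IsShadowOf (Image (swap x y) (sh τ)) g →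
     g ≡ σ ⊎ AdjΛ σ g)
lemma4p2 M =
  (λ _ _ x-vertex y-vertex x≢y x∼y _ → ∼-meets-facets x-vertex y-vertex x≢y x∼y) ,
  (λ _ _ _ α∩A≡∅ B → adjoin-proper-subclass B α∩A≡∅) ,
  (λ U U-vertices → mk⇔ (hat-isFaceShadow U) (isFaceShadow-from-hat U U-vertices)) ,
  (λ _ _ _ _ adj _ _ x-vertex y-vertex → transposed-neighbour adj x-vertex y-vertex)
  where open Properties M
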